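{- For every positive integer $n$, $$\sum_{\sigma\in B_n}\prod_{i\in\overleftarrow{\mathrm{Min}}_0(\sigma)}x_i\cdot\prod_{i\in\overleftarrow{\mathrm{Min}}_1(\sigma)}t_i\cdot q^{\mathrm{fmaj}(\sigma)}=\prod_{j=1}^n\bigl(x_j+q+q^2+\cdots+q^{2j-2}+q^{2j-1}t_j\bigr).$$
   Context: $B_n=C_2\wr S_n$ is the group of signed permutations $\sigma=[\sigma(1),\dots,\sigma(n)]$ of $\{\pm1,\dots,\pm n\}$ with $\sigma(-j)=-\sigma(j)$; $|\sigma|=[|\sigma(1)|,\dots,|\sigma(n)|]\in S_n$; set $\sigma(0)=0$. $\overleftarrow{\mathrm{Min}}_0(\sigma)$ (resp. $\overleftarrow{\mathrm{Min}}_1(\sigma)$) is the set of values $|\sigma(i)|$ which are right-to-left minima of $|\sigma|$ (i.e. $|\sigma(i)|<|\sigma(j)|$ for all $j>i$) with $\sigma(i)>0$ (resp. $\sigma(i)<0$). Let $Des_A(\sigma)=\{0\le i\le n-1:\sigma(i)>\sigma(i+1)\}$ (usual order on integers), $maj_A(\sigma)=\sum_{i\in Des_A(\sigma)}i$, $neg(\sigma)=\#\{i:\sigma(i)<0\}$, and the flag major index $\mathrm{fmaj}(\sigma)=2\,maj_A(\sigma)+neg(\sigma)$. -}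

module Defs where

open import Level using (Level)
open import Data.Bool using (Bool; true; false; if_then_else_; _∧_; not)
open import Data.Nat using (ℕ; zero; suc; _∸_; _<ᵇ_; _≡ᵇ_)
import Data.Nat as ℕ
open import Data.Integer using (ℤ; +_; -_; ∣_∣) renaming (_<_ to _<ℤ_)
open import Data.Integer.Properties using () renaming (_<?_ to _<ℤ?_)
open import Data.List using (List; []; _∷_; map; foldr; upTo; _++_; concatMap; filterᵇ; length)
open import Data.Bool.ListAction using (any; all)
open import Relation.Nullary.Decidable using (⌊_⌋)
open import Algebra.Bundles using (CommutativeSemiring)

-- Signed permutations of {±1,…,±n}, represented by their window
-- [σ(1),…,σ(n)] as a list of integers.

allLists : {A : Set} → ℕ → List A → List (List A)
allLists zero    L = [] ∷ []
allLists (suc k) L = concatMap (λ a → map (a ∷_) (allLists k L)) L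

oneTo : ℕ → List ℕ
oneTo n = map suc (upTo n)

signedValues : ℕ → List ℤ
signedValues n = map +_ (oneTo n) ++ map (λ k → - (+ k)) (oneTo n)

distinct : List ℕ → Bool
distinct []       = true
distinct (a ∷ as) = not (any (a ≡ᵇ_) as) ∧ distinct as

-- B_n: words σ(1)…σ(n) with entries in {±1..±n} whose absolute values
-- are pairwise distinct (hence |σ| ∈ S_n).  Each element appears once.
B : ℕ → List (List ℤ)
B n = filterᵇ (λ σ → distinct (map ∣_∣ σ)) (allLists n (signedValues n))

_<ᵇℤ_ : ℤ → ℤ → Bool
a <ᵇℤ b = ⌊ a <ℤ? b ⌋

zeroℤ : ℤ
zeroℤ = + 0

descents : ℕ → List ℤ → List ℕ
descents i []           = []
descents i (a ∷ [])     = []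
descents i (a ∷ b ∷ w)  =
  if b <ᵇℤ a then i ∷ descents (suc i) (b ∷ w) else descents (suc i) (b ∷ w)

sumℕ : List ℕ → ℕ
sumℕ = foldr ℕ._+_ 0

-- Des_A(σ) computed on σ(0)σ(1)…σ(n) with σ(0) = 0
majA : List ℤ → ℕ
majA σ = sumℕ (descents 0 (zeroℤ ∷ σ))

neg : List ℤ → ℕ
neg σ = length (filterᵇ (λ a → a <ᵇℤ zeroℤ) σ)

fmaj : List ℤ → ℕ
fmaj σ = 2 ℕ.* majA σ ℕ.+ neg σ

module _ {c ℓ : Level} (R : CommutativeSemiring c ℓ) where
  open CommutativeSemiring R

  pow : Carrier → ℕ → Carrier
  pow q zero    = 1#
  pow q (suc k) = q * pow q k

  sumR : List Carrier → Carrier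
  sumR = foldr _+_ 0#

  prodR : List Carrier → Carrier
  prodR = foldr _*_ 1#

  -- ∏_{i ∈ Min₀(σ)} x_i · ∏_{i ∈ Min₁(σ)} t_i, where the right-to-left
  -- minima of |σ| are the entries σ(i) with |σ(i)| < |σ(j)| for all j > i.
  rlMinWeight : (ℕ → Carrier) → (ℕ → Carrier) → List ℤ → Carrier
  rlMinWeight x t []      = 1#
  rlMinWeight x t (a ∷ w) =
    (if all (λ b → ∣ a ∣ <ᵇ ∣ b ∣) w
       then (if a <ᵇℤ zeroℤ then t ∣ a ∣ else x ∣ a ∣)
       else 1#)
    * rlMinWeight x t w

  lhs : ℕ → (ℕ → Carrier) → (ℕ → Carrier) → Carrier → Carrier
  lhs n x t q = sumR (map (λ σ → rlMinWeight x t σ * pow q (fmaj σ)) (B n))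

  rhs : ℕ → (ℕ → Carrier) → (ℕ → Carrier) → Carrier → Carrier
  rhs n x t q = prodR (map factor (oneTo n))
    where
    factor : ℕ → Carrier
    factor j = x j + sumR (map (pow q) (oneTo (2 ℕ.* j ∸ 2))) + pow q (2 ℕ.* j ∸ 1) * t j

-- Every signed permutation of length m + 1 arises exactly once by inserting +(m+1) or -(m+1)
-- into one of the m + 1 gaps of a signed permutation σ of length m.  The inserted letter has
-- the largest absolute value, so it is a right-to-left minimum only in the last gap (weight
-- x_{m+1} or t_{m+1}) and leaves the other minima alone.  Inserting in front of a letter b
-- that follows p raises fmaj by 2g + 1 (for -(m+1)) and 2g + 2 (for +(m+1)), where g is the
-- number of descents from b on, plus the position of p when p b is an ascent.  Summing these
-- shifts along σ by induction gives exactly x_{m+1} + q + ... + q^{2m} + q^{2m+1} t_{m+1},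
-- so the left-hand side satisfies the same recursion in n as the product.
module Submission where

open import Defs
open import Level using (Level)
open import Algebra.Bundles using (CommutativeSemiring)
open import Data.Bool using (Bool; true; false; if_then_else_; _∧_; not; T; T?)
open import Data.Bool.Properties using (∧-comm; T-≡; T-not-≡)
open import Data.Bool.ListAction using (any; all)
open import Data.Nat as ℕ using (ℕ; zero; suc; _≤_; _<_; _≡ᵇ_; _<ᵇ_; s≤s)
import Data.Nat.Properties as ℕₚ
open import Data.Nat.Properties using (≡ᵇ⇒≡; ≡⇒≡ᵇ; _≟_; <-irrefl; n<1+n; <-≤-trans)
open import Data.Integer as ℤ using (ℤ; +_; -_; -[1+_]; ∣_∣)
import Data.Integer.Properties as ℤ
open import Data.Integer.Properties using (∣-i∣≡∣i∣) renaming (_<?_ to _<ℤ?_)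
open import Data.List using (List; []; _∷_; map; _++_; concatMap; filterᵇ; length; upTo)
open import Data.List.Properties
  using (filter-++; ++-identityʳ; filter-all; filter-none; filter-accept; filter-reject; filter-notAll;
         concatMap-cong; map-++; map-∘; length-map; length-upTo; upTo-∷ʳ)
open import Data.List.Membership.Propositional using (_∈_; find)
open import Data.List.Membership.Propositional.Properties
  using (∈-filter⁺; ∈-filter⁻; ∈-map⁻; ∈-++⁻; ∈-concatMap⁻; ∈-upTo⁻)
open import Data.List.Relation.Unary.Any as Any using (Any; here; there)
open import Data.List.Relation.Unary.All as All using (All; []; _∷_)
open import Data.Product using (_×_; _,_; proj₁; proj₂)
open import Data.Sum using (inj₁; inj₂)
open import Function using (_∘_; Equivalence)
open import Relation.Nullary using (¬_)
open import Relation.Nullary.Decidable using (dec-true; dec-false; isYes≗does)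
open import Relation.Binary.PropositionalEquality
  using (_≡_; _≢_; refl; sym; trans; cong; cong₂; subst; module ≡-Reasoning)

module _ {A : Set} where

  filterᵇ-cong : {p r : A → Bool} → (∀ a → p a ≡ r a) → ∀ xs → filterᵇ p xs ≡ filterᵇ r xs
  filterᵇ-cong e [] = refl
  filterᵇ-cong {r = r} e (a ∷ xs) rewrite e a with r a
  ... | true = cong (a ∷_) (filterᵇ-cong e xs)
  ... | false = filterᵇ-cong e xs

  filterᵇ-false : (xs : List A) → filterᵇ (λ _ → false) xs ≡ []
  filterᵇ-false [] = refl
  filterᵇ-false (a ∷ xs) = filterᵇ-false xs

  filterᵇ-∧ : (p r : A → Bool) → ∀ xs → filterᵇ (λ a → p a ∧ r a) xs ≡ filterᵇ r (filterᵇ p xs)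
  filterᵇ-∧ p r [] = refl
  filterᵇ-∧ p r (a ∷ xs) with p a
  ... | false = filterᵇ-∧ p r xs
  ... | true with r a
  ...   | true = cong (a ∷_) (filterᵇ-∧ p r xs)
  ...   | false = filterᵇ-∧ p r xs

  filterᵇ-comm : (p r : A → Bool) → ∀ xs → filterᵇ p (filterᵇ r xs) ≡ filterᵇ r (filterᵇ p xs)
  filterᵇ-comm p r xs = begin
    filterᵇ p (filterᵇ r xs)        ≡⟨ filterᵇ-∧ r p xs ⟨
    filterᵇ (λ a → r a ∧ p a) xs    ≡⟨ filterᵇ-cong (λ a → ∧-comm (r a) (p a)) xs ⟩
    filterᵇ (λ a → p a ∧ r a) xs    ≡⟨ filterᵇ-∧ p r xs ⟩
    filterᵇ r (filterᵇ p xs)        ∎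
    where open ≡-Reasoning

module _ {A B : Set} where

  filterᵇ-map : (p : B → Bool) (f : A → B) → ∀ xs → filterᵇ p (map f xs) ≡ map f (filterᵇ (p ∘ f) xs)
  filterᵇ-map p f [] = refl
  filterᵇ-map p f (a ∷ xs) with p (f a)
  ... | true = cong (f a ∷_) (filterᵇ-map p f xs)
  ... | false = filterᵇ-map p f xs

  filterᵇ-concatMap : (p : B → Bool) (f : A → List B) → ∀ xs →
    filterᵇ p (concatMap f xs) ≡ concatMap (filterᵇ p ∘ f) xs
  filterᵇ-concatMap p f [] = refl
  filterᵇ-concatMap p f (a ∷ xs) =
    trans (filter-++ _ (f a) _) (cong (filterᵇ p (f a) ++_) (filterᵇ-concatMap p f xs))

  concatMap-≡[] : (f : A → List B) → ∀ xs → (∀ {a} → a ∈ xs → f a ≡ []) → concatMap f xs ≡ []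
  concatMap-≡[] f [] _ = refl
  concatMap-≡[] f (a ∷ xs) f≡[] rewrite f≡[] (here refl) = concatMap-≡[] f xs (f≡[] ∘ there)

allLists-filterᵇ : {A : Set} (p : A → Bool) → ∀ k L →
  filterᵇ (all p) (allLists k L) ≡ allLists k (filterᵇ p L)
allLists-filterᵇ p zero L = refl
allLists-filterᵇ p (suc k) L = begin
  filterᵇ (all p) (concatMap (λ a → map (a ∷_) W) L)
    ≡⟨ filterᵇ-concatMap (all p) _ L ⟩
  concatMap (λ a → filterᵇ (all p) (map (a ∷_) W)) L
    ≡⟨ concatMap-cong (λ a → filterᵇ-map (all p) (a ∷_) W) L ⟩
  concatMap (λ a → map (a ∷_) (filterᵇ (λ w → p a ∧ all p w) W)) L
    ≡⟨ guarded L ⟩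
  concatMap (λ a → map (a ∷_) (filterᵇ (all p) W)) (filterᵇ p L)
    ≡⟨ cong (λ V → concatMap (λ a → map (a ∷_) V) (filterᵇ p L)) (allLists-filterᵇ p k L) ⟩
  concatMap (λ a → map (a ∷_) (allLists k (filterᵇ p L))) (filterᵇ p L) ∎
  where
  open ≡-Reasoning
  W = allLists k L
  guarded : ∀ xs → concatMap (λ a → map (a ∷_) (filterᵇ (λ w → p a ∧ all p w) W)) xs
                 ≡ concatMap (λ a → map (a ∷_) (filterᵇ (all p) W)) (filterᵇ p xs)
  guarded [] = refl
  guarded (a ∷ xs) with p a
  ... | true = cong (map (a ∷_) (filterᵇ (all p) W) ++_) (guarded xs)
  ... | false = cong₂ _++_ (cong (map (a ∷_)) (filterᵇ-false W)) (guarded xs)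

T⇒¬T-not : ∀ {b} → T b → ¬ T (not b)
T⇒¬T-not {true} _ ()

≢⇒T-not-≡ᵇ : ∀ {m n} → m ≢ n → T (not (m ≡ᵇ n))
≢⇒T-not-≡ᵇ {m} {n} m≢n = Equivalence.from T-not-≡ (dec-false (m ≟ n) m≢n)

insertions laterInsertions : {X : Set} → List X → List X → List (List X)
insertions A w = map (_∷ w) A ++ laterInsertions A w
laterInsertions A [] = []
laterInsertions A (b ∷ w) = map (b ∷_) (insertions A w)

all-insertions : {X : Set} (P : X → Bool) {A : List X} → (∀ {c} → c ∈ A → P c ≡ true) →
  ∀ w {u} → u ∈ insertions A w → all P u ≡ all P w
all-insertions P {A} PA w u∈ with ∈-++⁻ (map (_∷ w) A) u∈
... | inj₁ u∈front with ∈-map⁻ (_∷ w) u∈front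
...   | c , c∈A , refl = cong (_∧ all P w) (PA c∈A)
all-insertions P PA (b ∷ w) u∈ | inj₂ u∈later with ∈-map⁻ (b ∷_) u∈later
...   | u′ , u′∈ , refl = cong (P b ∧_) (all-insertions P PA w u′∈)

absDistinct : List ℤ → Bool
absDistinct σ = distinct (map ∣_∣ σ)

words : ℕ → List ℤ → List (List ℤ)
words k L = filterᵇ absDistinct (allLists k L)

withAbs without : ℕ → List ℤ → List ℤ
withAbs n = filterᵇ (λ b → n ≡ᵇ ∣ b ∣)
without n = filterᵇ (λ b → not (n ≡ᵇ ∣ b ∣))

abs-withAbs : ∀ {n L c} → c ∈ withAbs n L → ∣ c ∣ ≡ n
abs-withAbs {n} {L} {c} c∈ =
  sym (≡ᵇ⇒≡ n ∣ c ∣ (proj₂ (∈-filter⁻ (T? ∘ (λ b → n ≡ᵇ ∣ b ∣)) {xs = L} c∈)))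

withAbs-without : ∀ {n m} → m ≢ n → ∀ L → withAbs n (without m L) ≡ withAbs n L
withAbs-without {n} {m} m≢n L = trans (filterᵇ-comm _ _ L) (filter-all _ (All.tabulate keeps))
  where
  keeps : ∀ {c} → c ∈ withAbs n L → T (not (m ≡ᵇ ∣ c ∣))
  keeps c∈ = ≢⇒T-not-≡ᵇ (λ m≡c → m≢n (trans m≡c (abs-withAbs {L = L} c∈)))

not-any≡all-not : ∀ n w → not (any (n ≡ᵇ_) (map ∣_∣ w)) ≡ all (λ b → not (n ≡ᵇ ∣ b ∣)) w
not-any≡all-not n [] = refl
not-any≡all-not n (b ∷ w) with n ≡ᵇ ∣ b ∣
... | true = refl
... | false = not-any≡all-not n w

words-suc : ∀ k L → words (suc k) L ≡ concatMap (λ a → map (a ∷_) (words k (without ∣ a ∣ L))) L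
words-suc k L = begin
  filterᵇ absDistinct (concatMap (λ a → map (a ∷_) (allLists k L)) L)
    ≡⟨ filterᵇ-concatMap absDistinct _ L ⟩
  concatMap (λ a → filterᵇ absDistinct (map (a ∷_) (allLists k L))) L
    ≡⟨ concatMap-cong (λ a → trans (filterᵇ-map absDistinct (a ∷_) (allLists k L)) (cong (map (a ∷_)) (tails a))) L ⟩
  concatMap (λ a → map (a ∷_) (words k (without ∣ a ∣ L))) L ∎
  where
  open ≡-Reasoning
  tails : ∀ a → filterᵇ (absDistinct ∘ (a ∷_)) (allLists k L) ≡ words k (without ∣ a ∣ L)
  tails a = begin
    filterᵇ (absDistinct ∘ (a ∷_)) (allLists k L)
      ≡⟨ filterᵇ-cong (λ w → cong (_∧ absDistinct w) (not-any≡all-not ∣ a ∣ w)) (allLists k L) ⟩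
    filterᵇ (λ w → all avoids w ∧ absDistinct w) (allLists k L)
      ≡⟨ filterᵇ-∧ (all avoids) absDistinct (allLists k L) ⟩
    filterᵇ absDistinct (filterᵇ (all avoids) (allLists k L))
      ≡⟨ cong (filterᵇ absDistinct) (allLists-filterᵇ avoids k L) ⟩
    words k (without ∣ a ∣ L) ∎
    where avoids = λ b → not (∣ a ∣ ≡ᵇ ∣ b ∣)

words-pigeonhole : ∀ k L (U : List ℕ) → (∀ {b} → b ∈ L → ∣ b ∣ ∈ U) → length U < k → words k L ≡ []
words-pigeonhole (suc k) L U absL∈U (s≤s U≤k) =
  trans (words-suc k L) (concatMap-≡[] _ L (cong (map _) ∘ shorter))
  where
  shorter : ∀ {a} → a ∈ L → words k (without ∣ a ∣ L) ≡ []
  shorter {a} a∈L = words-pigeonhole k (without ∣ a ∣ L) (filterᵇ (λ u → not (∣ a ∣ ≡ᵇ u)) U)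
    (λ b∈ → let b∈L , avoids = ∈-filter⁻ _ b∈ in ∈-filter⁺ _ (absL∈U b∈L) avoids)
    (<-≤-trans (filter-notAll _ U (Any.map (λ { refl → T⇒¬T-not (≡⇒≡ᵇ ∣ a ∣ ∣ a ∣ refl) }) (absL∈U a∈L))) U≤k)

∈-words⁻ : ∀ k L {σ} → σ ∈ words k L → length σ ≡ k × All (_∈ L) σ
∈-words⁻ zero L (here refl) = refl , []
∈-words⁻ (suc k) L {σ} σ∈
  with find (∈-concatMap⁻ (λ a → map (a ∷_) (words k (without ∣ a ∣ L))) {xs = L}
                          (subst (σ ∈_) (words-suc k L) σ∈))
... | a , a∈L , σ∈′ with ∈-map⁻ (a ∷_) σ∈′
...   | w , w∈ , refl with ∈-words⁻ k (without ∣ a ∣ L) w∈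
...     | len , w⊆ = cong suc len , a∈L ∷ All.map (proj₁ ∘ ∈-filter⁻ _) w⊆

oneTo-suc : ∀ n → oneTo (suc n) ≡ oneTo n ++ suc n ∷ []
oneTo-suc n = trans (cong (map suc) (sym (upTo-∷ʳ n))) (map-++ suc (upTo n) (n ∷ []))

length-oneTo : ∀ n → length (oneTo n) ≡ n
length-oneTo n = trans (length-map suc (upTo n)) (length-upTo n)

∈-oneTo⁻ : ∀ {n k} → k ∈ oneTo n → k < suc n
∈-oneTo⁻ k∈ with ∈-map⁻ suc k∈
... | j , j∈ , refl = s≤s (∈-upTo⁻ j∈)

signedPair : ℕ → List ℤ
signedPair n = + n ∷ - (+ n) ∷ []

∈-signedValues⁻ : ∀ n {b} → b ∈ signedValues n → ∣ b ∣ ∈ oneTo n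
∈-signedValues⁻ n b∈ with ∈-++⁻ (map +_ (oneTo n)) b∈
... | inj₁ b∈+ with ∈-map⁻ +_ b∈+
...   | k , k∈ , refl = k∈
∈-signedValues⁻ n b∈ | inj₂ b∈- with ∈-map⁻ (λ k → - (+ k)) b∈-
...   | k , k∈ , refl = subst (_∈ oneTo n) (sym (∣-i∣≡∣i∣ (+ k))) k∈

filterᵇ-signedValues : (p : ℕ → Bool) → ∀ n →
  filterᵇ (p ∘ ∣_∣) (signedValues n) ≡ map +_ (filterᵇ p (oneTo n)) ++ map (λ k → - (+ k)) (filterᵇ p (oneTo n))
filterᵇ-signedValues p n = trans (filter-++ _ (map +_ (oneTo n)) _) (cong₂ _++_
  (filterᵇ-map (p ∘ ∣_∣) +_ (oneTo n))
  (trans (filterᵇ-map (p ∘ ∣_∣) _ (oneTo n))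
         (cong (map _) (filterᵇ-cong (λ k → cong p (∣-i∣≡∣i∣ (+ k))) (oneTo n)))))

module _ (m : ℕ) where

  private
    oneTo-fresh : All (suc m ≢_) (oneTo m)
    oneTo-fresh = All.tabulate (λ k∈ eq → <-irrefl (sym eq) (∈-oneTo⁻ k∈))

    filterᵇ-oneTo-suc : (p : ℕ → Bool) →
      filterᵇ p (oneTo (suc m)) ≡ filterᵇ p (oneTo m) ++ filterᵇ p (suc m ∷ [])
    filterᵇ-oneTo-suc p = trans (cong (filterᵇ p) (oneTo-suc m)) (filter-++ _ (oneTo m) _)

    signed : List ℕ → List ℤ
    signed l = map +_ l ++ map (λ k → - (+ k)) l

    is-top : ℕ → Bool
    is-top k = suc m ≡ᵇ k

    top-T : T (is-top (suc m))
    top-T = ≡⇒≡ᵇ (suc m) (suc m) refl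

  withAbs-signedValues : withAbs (suc m) (signedValues (suc m)) ≡ signedPair (suc m)
  withAbs-signedValues = trans (filterᵇ-signedValues is-top (suc m)) (cong signed (trans (filterᵇ-oneTo-suc is-top)
    (cong₂ _++_ (filter-none (T? ∘ is-top) (All.map (λ ne → ne ∘ ≡ᵇ⇒≡ _ _) oneTo-fresh))
                (filter-accept (T? ∘ is-top) top-T))))

  without-signedValues : without (suc m) (signedValues (suc m)) ≡ signedValues m
  without-signedValues = trans (filterᵇ-signedValues (not ∘ is-top) (suc m))
    (cong signed (trans (filterᵇ-oneTo-suc (not ∘ is-top))
      (trans (cong₂ _++_ (filter-all (T? ∘ not ∘ is-top) (All.map ≢⇒T-not-≡ᵇ oneTo-fresh))
                         (filter-reject (T? ∘ not ∘ is-top) {x = suc m} {xs = []} (T⇒¬T-not top-T)))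
             (++-identityʳ (oneTo m)))))

words-suc-signedValues : ∀ m → words (suc m) (signedValues m) ≡ []
words-suc-signedValues m = words-pigeonhole (suc m) (signedValues m) (oneTo m) (∈-signedValues⁻ m)
  (subst (_< suc m) (sym (length-oneTo m)) (n<1+n m))

∈-B⁻ : ∀ m {σ} → σ ∈ B m → length σ ≡ m × All (λ b → ∣ b ∣ < suc m) σ
∈-B⁻ m σ∈ with ∈-words⁻ m (signedValues m) σ∈
... | len , σ⊆ = len , All.map (∈-oneTo⁻ ∘ ∈-signedValues⁻ m) σ⊆

<ᵇℤ-true : ∀ {a b} → a ℤ.< b → (a <ᵇℤ b) ≡ true
<ᵇℤ-true {a} {b} a<b = trans (isYes≗does (a <ℤ? b)) (dec-true (a <ℤ? b) a<b)

<ᵇℤ-false : ∀ {a b} → b ℤ.< a → (a <ᵇℤ b) ≡ false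
<ᵇℤ-false {a} {b} b<a = trans (isYes≗does (a <ℤ? b)) (dec-false (a <ℤ? b) (ℤ.<-asym b<a))

module _ {m : ℕ} where

  abs<⇒lower : ∀ {b} → ∣ b ∣ < suc m → -[1+ m ] ℤ.< b
  abs<⇒lower {+ _} _ = ℤ.-<+
  abs<⇒lower { -[1+ _ ]} (s≤s k<m) = ℤ.-<- k<m

  abs<⇒upper : ∀ {b} → ∣ b ∣ < suc m → b ℤ.< + suc m
  abs<⇒upper {+ _} k<1+m = ℤ.+<+ k<1+m
  abs<⇒upper { -[1+ _ ]} _ = ℤ.-<+

-- ℕ arithmetic is opened only locally: the semiring modules below reuse the names _+_ and _*_.
module _ where

  open import Data.Nat using (_+_; _*_)
  open import Data.Nat.Properties using (+-suc; +-assoc; +-comm)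
  open import Data.Nat.Solver using (module +-*-Solver)
  open +-*-Solver using (solve; _:+_; _:*_; _:=_; con)

  descentSum : ℕ → List ℤ → ℕ
  descentSum i v = sumℕ (descents i v)

  descentCount ascentCount : List ℤ → ℕ
  descentCount [] = 0
  descentCount (_ ∷ []) = 0
  descentCount (a ∷ b ∷ w) = (if b <ᵇℤ a then 1 else 0) + descentCount (b ∷ w)
  ascentCount [] = 0
  ascentCount (_ ∷ []) = 0
  ascentCount (a ∷ b ∷ w) = (if b <ᵇℤ a then 0 else 1) + ascentCount (b ∷ w)

  descentSum-cons : ∀ i a b w →
    descentSum i (a ∷ b ∷ w) ≡ (if b <ᵇℤ a then i else 0) + descentSum (suc i) (b ∷ w)
  descentSum-cons i a b w with b <ᵇℤ a
  ... | true = refl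
  ... | false = refl

  descentSum-suc : ∀ i v → descentSum (suc i) v ≡ descentSum i v + descentCount v
  descentSum-suc i [] = refl
  descentSum-suc i (a ∷ []) = refl
  descentSum-suc i (a ∷ v@(b ∷ w)) with descentSum-suc (suc i) v | b <ᵇℤ a
  ... | ih | true = trans (cong (λ s → suc i + s) ih) (sym (trans (+-suc (i + _) _) (cong suc (+-assoc i _ _))))
  ... | ih | false = ih

  descentCount+ascentCount : ∀ a w → descentCount (a ∷ w) + ascentCount (a ∷ w) ≡ length w
  descentCount+ascentCount a [] = refl
  descentCount+ascentCount a (b ∷ w) with b <ᵇℤ a
  ... | true = cong suc (descentCount+ascentCount b w)
  ... | false = trans (+-suc _ _) (cong suc (descentCount+ascentCount b w))

  exponent : ℕ → ℤ → List ℤ → ℕ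
  exponent i p u = 2 * descentSum i (p ∷ u) + neg u

  exponentStep : ℕ → ℤ → ℤ → ℕ
  exponentStep i p b = 2 * (if b <ᵇℤ p then i else 0) + (if b <ᵇℤ zeroℤ then 1 else 0)

  gap : ℕ → ℤ → ℤ → List ℤ → ℕ
  gap i p b w = if b <ᵇℤ p then descentCount (b ∷ w) else i + descentCount (b ∷ w)

  neg-cons : ∀ b u → neg (b ∷ u) ≡ (if b <ᵇℤ zeroℤ then 1 else 0) + neg u
  neg-cons b u with b <ᵇℤ zeroℤ
  ... | true = refl
  ... | false = refl

  exponent-cons : ∀ i p b u → exponent i p (b ∷ u) ≡ exponentStep i p b + exponent (suc i) b u
  exponent-cons i p b u = trans (cong₂ (λ s n → 2 * s + n) (descentSum-cons i p b u) (neg-cons b u))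
    (solve 4 (λ e s ν n → con 2 :* (e :+ s) :+ (ν :+ n) := (con 2 :* e :+ ν) :+ (con 2 :* s :+ n)) refl
           (if b <ᵇℤ p then i else 0) (descentSum (suc i) (b ∷ u)) (if b <ᵇℤ zeroℤ then 1 else 0) (neg u))

  private
    descentSum-step : ∀ {β} i a b w → (b <ᵇℤ a) ≡ β →
      descentSum i (a ∷ b ∷ w) ≡ (if β then i else 0) + descentSum (suc i) (b ∷ w)
    descentSum-step i a b w refl = descentSum-cons i a b w

    exponent-arith+ : ∀ β i s d n →
      2 * (suc i + (s + d)) + n ≡ 2 * ((if β then i else 0) + s) + n + 2 * suc (if β then d else i + d)
    exponent-arith+ true = solve 4 (λ i s d n →
      con 2 :* ((con 1 :+ i) :+ (s :+ d)) :+ n := con 2 :* (i :+ s) :+ n :+ con 2 :* (con 1 :+ d)) refl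
    exponent-arith+ false = solve 4 (λ i s d n →
      con 2 :* ((con 1 :+ i) :+ (s :+ d)) :+ n := con 2 :* s :+ n :+ con 2 :* (con 1 :+ (i :+ d))) refl

    exponent-arith- : ∀ β i s d n →
      2 * (i + (s + d)) + suc n ≡ 2 * ((if β then i else 0) + s) + n + suc (2 * (if β then d else i + d))
    exponent-arith- true = solve 4 (λ i s d n →
      con 2 :* (i :+ (s :+ d)) :+ (con 1 :+ n) := con 2 :* (i :+ s) :+ n :+ (con 1 :+ con 2 :* d)) refl
    exponent-arith- false = solve 4 (λ i s d n →
      con 2 :* (i :+ (s :+ d)) :+ (con 1 :+ n) := con 2 :* s :+ n :+ (con 1 :+ con 2 :* (i :+ d))) refl

  module _ {m : ℕ} (i : ℕ) (p b : ℤ) (w : List ℤ) (p<1+m : ∣ p ∣ < suc m) (b<1+m : ∣ b ∣ < suc m) where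

    private
      S D n : ℕ
      S = descentSum (suc i) (b ∷ w)
      D = descentCount (b ∷ w)
      n = neg (b ∷ w)

      exponent-unfold : exponent i p (b ∷ w) ≡ 2 * ((if b <ᵇℤ p then i else 0) + S) + n
      exponent-unfold = cong (λ s → 2 * s + n) (descentSum-cons i p b w)

    exponent-insert+ : exponent i p (+ suc m ∷ b ∷ w) ≡ exponent i p (b ∷ w) + 2 * suc (gap i p b w)
    exponent-insert+ = begin
      2 * descentSum i (p ∷ + suc m ∷ b ∷ w) + n
        ≡⟨ cong (λ s → 2 * s + n)
             (trans (descentSum-step i p (+ suc m) (b ∷ w) (<ᵇℤ-false (abs<⇒upper p<1+m)))
             (trans (descentSum-step (suc i) (+ suc m) b w (<ᵇℤ-true (abs<⇒upper b<1+m)))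
                    (cong (λ s → suc i + s) (descentSum-suc (suc i) (b ∷ w))))) ⟩
      2 * (suc i + (S + D)) + n
        ≡⟨ exponent-arith+ (b <ᵇℤ p) i S D n ⟩
      2 * ((if b <ᵇℤ p then i else 0) + S) + n + 2 * suc (gap i p b w)
        ≡⟨ cong (_+ 2 * suc (gap i p b w)) exponent-unfold ⟨
      exponent i p (b ∷ w) + 2 * suc (gap i p b w) ∎
      where open ≡-Reasoning

    exponent-insert- : exponent i p (-[1+ m ] ∷ b ∷ w) ≡ exponent i p (b ∷ w) + suc (2 * gap i p b w)
    exponent-insert- = begin
      2 * descentSum i (p ∷ -[1+ m ] ∷ b ∷ w) + suc n
        ≡⟨ cong (λ s → 2 * s + suc n)
             (trans (descentSum-step i p -[1+ m ] (b ∷ w) (<ᵇℤ-true (abs<⇒lower p<1+m)))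
             (cong (λ s → i + s) (trans (descentSum-step (suc i) -[1+ m ] b w (<ᵇℤ-false (abs<⇒lower b<1+m)))
                                        (descentSum-suc (suc i) (b ∷ w))))) ⟩
      2 * (i + (S + D)) + suc n
        ≡⟨ exponent-arith- (b <ᵇℤ p) i S D n ⟩
      2 * ((if b <ᵇℤ p then i else 0) + S) + n + suc (2 * gap i p b w)
        ≡⟨ cong (_+ suc (2 * gap i p b w)) exponent-unfold ⟨
      exponent i p (b ∷ w) + suc (2 * gap i p b w) ∎
      where open ≡-Reasoning

  module _ {m : ℕ} (i : ℕ) (p : ℤ) (p<1+m : ∣ p ∣ < suc m) where

    exponent-last+ : exponent i p (+ suc m ∷ []) ≡ 0
    exponent-last+ = cong (λ s → 2 * s + 0) (descentSum-step i p (+ suc m) [] (<ᵇℤ-false (abs<⇒upper p<1+m)))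

    exponent-last- : exponent i p (-[1+ m ] ∷ []) ≡ suc (2 * (i + 0))
    exponent-last- =
      trans (cong (λ s → 2 * s + 1) (descentSum-step i p -[1+ m ] [] (<ᵇℤ-true (abs<⇒lower p<1+m))))
            (+-comm _ 1)

module Sums {c ℓ : Level} (R : CommutativeSemiring c ℓ) where

  open CommutativeSemiring R renaming (refl to ≈-refl; sym to ≈-sym; trans to ≈-trans) hiding (zero)
  open import Algebra.Properties.CommutativeSemigroup +-commutativeSemigroup using (x∙yz≈y∙xz; interchange)
  open import Relation.Binary.Reasoning.Setoid setoid

  ∑ : {A : Set} → List A → (A → Carrier) → Carrier
  ∑ l f = sumR R (map f l)

  module _ {A : Set} where

    ∑-cong : {f g : A → Carrier} → ∀ l → (∀ {a} → a ∈ l → f a ≈ g a) → ∑ l f ≈ ∑ l g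
    ∑-cong [] _ = ≈-refl
    ∑-cong (a ∷ l) f≈g = +-cong (f≈g (here refl)) (∑-cong l (f≈g ∘ there))

    ∑-0 : ∀ (l : List A) → ∑ l (λ _ → 0#) ≈ 0#
    ∑-0 [] = ≈-refl
    ∑-0 (a ∷ l) = ≈-trans (+-identityˡ _) (∑-0 l)

    ∑-++ : ∀ l m (f : A → Carrier) → ∑ (l ++ m) f ≈ ∑ l f + ∑ m f
    ∑-++ [] m f = ≈-sym (+-identityˡ _)
    ∑-++ (a ∷ l) m f = ≈-trans (+-congˡ (∑-++ l m f)) (≈-sym (+-assoc _ _ _))

    ∑-+ : ∀ l (f g : A → Carrier) → ∑ l (λ a → f a + g a) ≈ ∑ l f + ∑ l g
    ∑-+ [] f g = ≈-sym (+-identityˡ 0#)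
    ∑-+ (a ∷ l) f g = ≈-trans (+-congˡ (∑-+ l f g)) (interchange _ _ _ _)

    ∑-*ˡ : ∀ k l (f : A → Carrier) → ∑ l (λ a → k * f a) ≈ k * ∑ l f
    ∑-*ˡ k [] f = ≈-sym (zeroʳ k)
    ∑-*ˡ k (a ∷ l) f = ≈-trans (+-congˡ (∑-*ˡ k l f)) (≈-sym (distribˡ k _ _))

    ∑-*ʳ : ∀ k l (f : A → Carrier) → ∑ l (λ a → f a * k) ≈ ∑ l f * k
    ∑-*ʳ k [] f = ≈-sym (zeroˡ k)
    ∑-*ʳ k (a ∷ l) f = ≈-trans (+-congˡ (∑-*ʳ k l f)) (≈-sym (distribʳ k _ _))

    ∑-partition : (p : A → Bool) → ∀ l f → ∑ l f ≈ ∑ (filterᵇ p l) f + ∑ (filterᵇ (not ∘ p) l) f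
    ∑-partition p [] f = ≈-sym (+-identityˡ 0#)
    ∑-partition p (a ∷ l) f with p a
    ... | true = ≈-trans (+-congˡ (∑-partition p l f)) (≈-sym (+-assoc _ _ _))
    ... | false = ≈-trans (+-congˡ (∑-partition p l f)) (x∙yz≈y∙xz _ _ _)

    prodR-++ : ∀ l l′ (f : A → Carrier) → prodR R (map f (l ++ l′)) ≈ prodR R (map f l) * prodR R (map f l′)
    prodR-++ [] l′ f = ≈-sym (*-identityˡ _)
    prodR-++ (a ∷ l) l′ f = ≈-trans (*-congˡ (prodR-++ l l′ f)) (≈-sym (*-assoc _ _ _))

  module _ {A B : Set} where

    ∑-map : (h : A → B) → ∀ l f → ∑ (map h l) f ≡ ∑ l (f ∘ h)
    ∑-map h l f = cong (sumR R) (sym (map-∘ l))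

    ∑-concatMap : (h : A → List B) → ∀ l f → ∑ (concatMap h l) f ≈ ∑ l (λ a → ∑ (h a) f)
    ∑-concatMap h [] f = ≈-refl
    ∑-concatMap h (a ∷ l) f = ≈-trans (∑-++ (h a) _ f) (+-congˡ (∑-concatMap h l f))

    ∑-comm : ∀ l m (f : A → B → Carrier) → ∑ l (λ a → ∑ m (f a)) ≈ ∑ m (λ b → ∑ l (λ a → f a b))
    ∑-comm [] m f = ≈-sym (∑-0 m)
    ∑-comm (a ∷ l) m f = ≈-trans (+-congˡ (∑-comm l m f)) (≈-sym (∑-+ m (f a) _))

  ∑-insertions : ∀ {X} A w (g : List X → Carrier) →
    ∑ (insertions A w) g ≈ ∑ A (λ c → g (c ∷ w)) + ∑ (laterInsertions A w) g
  ∑-insertions A w g = ≈-trans (∑-++ (map (_∷ w) A) _ g) (+-congʳ (reflexive (∑-map (_∷ w) A g)))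

  ∑-words-suc : ∀ k L g →
    ∑ (words (suc k) L) g ≈ ∑ L (λ a → ∑ (words k (without ∣ a ∣ L)) (g ∘ (a ∷_)))
  ∑-words-suc k L g = begin
    ∑ (words (suc k) L) g
      ≡⟨ cong (λ l → ∑ l g) (words-suc k L) ⟩
    ∑ (concatMap (λ a → map (a ∷_) (words k (without ∣ a ∣ L))) L) g
      ≈⟨ ∑-concatMap _ L g ⟩
    ∑ L (λ a → ∑ (map (a ∷_) (words k (without ∣ a ∣ L))) g)
      ≈⟨ ∑-cong L (λ {a} _ → reflexive (∑-map (a ∷_) (words k (without ∣ a ∣ L)) g)) ⟩
    ∑ L (λ a → ∑ (words k (without ∣ a ∣ L)) (g ∘ (a ∷_))) ∎

  -- A word of length k + 1 either avoids the letters of absolute value n, or contains exactly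
  -- one of them and arises from a word of length k over the other letters by inserting it.
  ∑-words-insert : ∀ n k L (g : List ℤ → Carrier) →
    ∑ (words (suc k) L) g
      ≈ ∑ (words (suc k) (without n L)) g + ∑ (words k (without n L)) (λ σ → ∑ (insertions (withAbs n L) σ) g)
  ∑-words-later : ∀ n k L (g : List ℤ → Carrier) →
    ∑ (without n L) (λ a → ∑ (words k (without ∣ a ∣ L)) (g ∘ (a ∷_)))
      ≈ ∑ (words (suc k) (without n L)) g + ∑ (words k (without n L)) (λ σ → ∑ (laterInsertions (withAbs n L) σ) g)

  ∑-words-insert n k L g = begin
    ∑ (words (suc k) L) g
      ≈⟨ ∑-words-suc k L g ⟩
    ∑ L F
      ≈⟨ ∑-partition (λ b → n ≡ᵇ ∣ b ∣) L F ⟩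
    ∑ A F + ∑ L′ F
      ≈⟨ +-cong front (∑-words-later n k L g) ⟩
    ∑ (words k L′) frontSum + (∑ (words (suc k) L′) g + ∑ (words k L′) laterSum)
      ≈⟨ x∙yz≈y∙xz _ _ _ ⟩
    ∑ (words (suc k) L′) g + (∑ (words k L′) frontSum + ∑ (words k L′) laterSum)
      ≈⟨ +-congˡ (∑-+ (words k L′) frontSum laterSum) ⟨
    ∑ (words (suc k) L′) g + ∑ (words k L′) (λ σ → frontSum σ + laterSum σ)
      ≈⟨ +-congˡ (∑-cong (words k L′) (λ {σ} _ → ≈-sym (∑-insertions A σ g))) ⟩
    ∑ (words (suc k) L′) g + ∑ (words k L′) (λ σ → ∑ (insertions A σ) g) ∎
    where
    A = withAbs n L
    L′ = without n L
    F = λ a → ∑ (words k (without ∣ a ∣ L)) (g ∘ (a ∷_))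
    frontSum = λ σ → ∑ A (λ c → g (c ∷ σ))
    laterSum = λ σ → ∑ (laterInsertions A σ) g
    front : ∑ A F ≈ ∑ (words k L′) frontSum
    front = ≈-trans
      (∑-cong A (λ {c} c∈A → reflexive (cong (λ m → ∑ (words k (without m L)) (g ∘ (c ∷_))) (abs-withAbs {n} {L} c∈A))))
      (∑-comm A (words k L′) (λ c σ → g (c ∷ σ)))

  ∑-words-later n zero L g = begin
    ∑ L′ (λ a → g (a ∷ []) + 0#)        ≈⟨ ∑-words-suc 0 L′ g ⟨
    ∑ (words 1 L′) g                    ≈⟨ +-identityʳ _ ⟨
    ∑ (words 1 L′) g + 0#               ≈⟨ +-congˡ (+-identityʳ 0#) ⟨
    ∑ (words 1 L′) g + (0# + 0#)        ∎
    where L′ = without n L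
  ∑-words-later n (suc k) L g = begin
    ∑ L′ (λ a → ∑ (words (suc k) (without ∣ a ∣ L)) (g ∘ (a ∷_)))
      ≈⟨ ∑-cong L′ (λ {a} a∈ → ≈-trans (∑-words-insert n k (without ∣ a ∣ L) (g ∘ (a ∷_))) (reflexive (shift a∈))) ⟩
    ∑ L′ (λ a → ∑ (words (suc k) (without ∣ a ∣ L′)) (g ∘ (a ∷_)) + ∑ (words k (without ∣ a ∣ L′)) (inserted a))
      ≈⟨ ∑-+ L′ _ _ ⟩
    ∑ L′ (λ a → ∑ (words (suc k) (without ∣ a ∣ L′)) (g ∘ (a ∷_)))
      + ∑ L′ (λ a → ∑ (words k (without ∣ a ∣ L′)) (inserted a))
      ≈⟨ +-congˡ (∑-cong L′ (λ {a} _ → ∑-cong (words k (without ∣ a ∣ L′))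
                                          (λ {σ} _ → reflexive (∑-map (a ∷_) (insertions A σ) g)))) ⟨
    ∑ L′ (λ a → ∑ (words (suc k) (without ∣ a ∣ L′)) (g ∘ (a ∷_)))
      + ∑ L′ (λ a → ∑ (words k (without ∣ a ∣ L′)) (laterSum ∘ (a ∷_)))
      ≈⟨ +-cong (∑-words-suc (suc k) L′ g) (∑-words-suc k L′ laterSum) ⟨
    ∑ (words (suc (suc k)) L′) g + ∑ (words (suc k) L′) laterSum ∎
    where
    A = withAbs n L
    L′ = without n L
    laterSum = λ σ → ∑ (laterInsertions A σ) g
    inserted : ℤ → List ℤ → Carrier
    inserted a σ = ∑ (insertions A σ) (g ∘ (a ∷_))
    shift : ∀ {a} → a ∈ L′ →
      ∑ (words (suc k) (without n (without ∣ a ∣ L))) (g ∘ (a ∷_))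
        + ∑ (words k (without n (without ∣ a ∣ L))) (λ σ → ∑ (insertions (withAbs n (without ∣ a ∣ L)) σ) (g ∘ (a ∷_)))
      ≡ ∑ (words (suc k) (without ∣ a ∣ L′)) (g ∘ (a ∷_)) + ∑ (words k (without ∣ a ∣ L′)) (inserted a)
    shift {a} a∈ =
      cong₂ (λ X Y → ∑ (words (suc k) X) (g ∘ (a ∷_)) + ∑ (words k X) (λ σ → ∑ (insertions Y σ) (g ∘ (a ∷_))))
            (filterᵇ-comm _ _ L) (withAbs-without a≢n L)
      where
      a≢n : ∣ a ∣ ≢ n
      a≢n eq = T⇒¬T-not (≡⇒≡ᵇ n ∣ a ∣ (sym eq)) (proj₂ (∈-filter⁻ (T? ∘ (λ b → not (n ≡ᵇ ∣ b ∣))) {xs = L} a∈))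

  ∑-B-suc : ∀ m g → ∑ (B (suc m)) g ≈ ∑ (B m) (λ σ → ∑ (insertions (signedPair (suc m)) σ) g)
  ∑-B-suc m g = begin
    ∑ (B (suc m)) g
      ≈⟨ ∑-words-insert (suc m) m (signedValues (suc m)) g ⟩
    ∑ (words (suc m) L′) g + ∑ (words m L′) (λ σ → ∑ (insertions (withAbs (suc m) (signedValues (suc m))) σ) g)
      ≡⟨ cong₂ (λ L A → ∑ (words (suc m) L) g + ∑ (words m L) (λ σ → ∑ (insertions A σ) g))
               (without-signedValues m) (withAbs-signedValues m) ⟩
    ∑ (words (suc m) (signedValues m)) g + ∑ (B m) inserted
      ≡⟨ cong (λ l → ∑ l g + ∑ (B m) inserted) (words-suc-signedValues m) ⟩
    0# + ∑ (B m) inserted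
      ≈⟨ +-identityˡ _ ⟩
    ∑ (B m) inserted ∎
    where
    L′ = without (suc m) (signedValues (suc m))
    inserted = λ σ → ∑ (insertions (signedPair (suc m)) σ) g

module GeneratingFunction {r ℓ : Level} (R : CommutativeSemiring r ℓ)
  (x t : ℕ → CommutativeSemiring.Carrier R) (q : CommutativeSemiring.Carrier R) where

  open CommutativeSemiring R renaming (refl to ≈-refl; sym to ≈-sym; trans to ≈-trans) hiding (zero)
  open Sums R
  open import Algebra.Solver.Ring.NaturalCoefficients.Default R
  open import Relation.Binary.Reasoning.Setoid setoid

  qpow : ℕ → Carrier
  qpow = pow R q

  qpow-+ : ∀ a b → qpow (a ℕ.+ b) ≈ qpow a * qpow b
  qpow-+ zero b = ≈-sym (*-identityˡ _)
  qpow-+ (suc a) b = ≈-trans (*-congˡ (qpow-+ a b)) (≈-sym (*-assoc _ _ _))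

  powSum : ℕ → ℕ → Carrier
  powSum a zero = 0#
  powSum a (suc k) = qpow a + powSum (suc a) k

  powSum-+ : ∀ a k l → powSum a (k ℕ.+ l) ≈ powSum a k + powSum (a ℕ.+ k) l
  powSum-+ a zero l = ≈-sym (≈-trans (+-identityˡ _) (reflexive (cong (λ b → powSum b l) (ℕₚ.+-identityʳ a))))
  powSum-+ a (suc k) l = ≈-trans
    (+-congˡ (≈-trans (powSum-+ (suc a) k l) (+-congˡ (reflexive (cong (λ b → powSum b l) (sym (ℕₚ.+-suc a k)))))))
    (≈-sym (+-assoc _ _ _))

  ∑-oneTo : ∀ k → ∑ (oneTo k) qpow ≈ powSum 1 k
  ∑-oneTo zero = ≈-refl
  ∑-oneTo (suc k) = begin
    ∑ (oneTo (suc k)) qpow                 ≡⟨ cong (λ l → ∑ l qpow) (oneTo-suc k) ⟩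
    ∑ (oneTo k ++ suc k ∷ []) qpow         ≈⟨ ∑-++ (oneTo k) _ qpow ⟩
    ∑ (oneTo k) qpow + powSum (suc k) 1    ≈⟨ +-congʳ (∑-oneTo k) ⟩
    powSum 1 k + powSum (suc k) 1          ≈⟨ powSum-+ 1 k 1 ⟨
    powSum 1 (k ℕ.+ 1)                     ≡⟨ cong (powSum 1) (ℕₚ.+-comm k 1) ⟩
    powSum 1 (suc k)                       ∎

  -- The weight of the word u when it follows the letter p at position i;
  -- weight 0 zeroℤ σ is the summand of lhs.
  weight : ℕ → ℤ → List ℤ → Carrier
  weight i p u = rlMinWeight R x t u * qpow (exponent i p u)

  rlMinFactor : ℤ → List ℤ → Carrier
  rlMinFactor b u = if all (λ c → ∣ b ∣ <ᵇ ∣ c ∣) u then (if b <ᵇℤ zeroℤ then t ∣ b ∣ else x ∣ b ∣) else 1#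

  rlMinWeight-notMin : ∀ a b w → (∣ a ∣ <ᵇ ∣ b ∣) ≡ false →
    rlMinWeight R x t (a ∷ b ∷ w) ≈ rlMinWeight R x t (b ∷ w)
  rlMinWeight-notMin a b w a≮b = ≈-trans
    (*-congʳ (reflexive (cong (λ β → if β ∧ all (λ c → ∣ a ∣ <ᵇ ∣ c ∣) w then letter else 1#) a≮b)))
    (*-identityˡ _)
    where letter = if a <ᵇℤ zeroℤ then t ∣ a ∣ else x ∣ a ∣

  weight-cons : ∀ i p b u → weight i p (b ∷ u) ≈ (rlMinFactor b u * qpow (exponentStep i p b)) * weight (suc i) b u
  weight-cons i p b u = begin
    (rlMinFactor b u * rlMinWeight R x t u) * qpow (exponent i p (b ∷ u))
      ≡⟨ cong (λ e → (rlMinFactor b u * rlMinWeight R x t u) * qpow e) (exponent-cons i p b u) ⟩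
    (rlMinFactor b u * rlMinWeight R x t u) * qpow (exponentStep i p b ℕ.+ exponent (suc i) b u)
      ≈⟨ *-congˡ (qpow-+ (exponentStep i p b) (exponent (suc i) b u)) ⟩
    (rlMinFactor b u * rlMinWeight R x t u) * (qpow (exponentStep i p b) * qpow (exponent (suc i) b u))
      ≈⟨ solve 4 (λ f r a e → (f :* r) :* (a :* e) := (f :* a) :* (r :* e)) ≈-refl _ _ _ _ ⟩
    (rlMinFactor b u * qpow (exponentStep i p b)) * weight (suc i) b u ∎

  weight-prepend : ∀ i p a v e → rlMinWeight R x t (a ∷ v) ≈ rlMinWeight R x t v →
    exponent i p (a ∷ v) ≡ exponent i p v ℕ.+ e → weight i p (a ∷ v) ≈ weight i p v * qpow e
  weight-prepend i p a v e rl≈ exp≡ = begin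
    rlMinWeight R x t (a ∷ v) * qpow (exponent i p (a ∷ v))     ≈⟨ *-cong rl≈ (reflexive (cong qpow exp≡)) ⟩
    rlMinWeight R x t v * qpow (exponent i p v ℕ.+ e)           ≈⟨ *-congˡ (qpow-+ (exponent i p v) e) ⟩
    rlMinWeight R x t v * (qpow (exponent i p v) * qpow e)      ≈⟨ *-assoc _ _ _ ⟨
    weight i p v * qpow e                                        ∎

  factor : ℕ → Carrier
  factor j = x j + sumR R (map qpow (oneTo (2 ℕ.* j ℕ.∸ 2))) + qpow (2 ℕ.* j ℕ.∸ 1) * t j

  module _ (m : ℕ) where

    -- Inserting ±(m+1) everywhere into a word w that follows p at position i multiplies its
    -- weight by Φ i D E in total, where D and E count the descents and ascents of p w.
    Φ : ℕ → ℕ → ℕ → Carrier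
    Φ i D E = x (suc m) + powSum 1 (2 ℕ.* D) + powSum (suc (2 ℕ.* (i ℕ.+ D))) (2 ℕ.* E)
              + qpow (suc (2 ℕ.* (i ℕ.+ (D ℕ.+ E)))) * t (suc m)

    Φ-descent : ∀ i D E → qpow (2 ℕ.* suc D) + (qpow (suc (2 ℕ.* D)) + Φ (suc i) D E) ≈ Φ i (suc D) E
    Φ-descent i D E = begin
      a + (b + (xN + low + high + tN))
        ≈⟨ solve 6 (λ a b xN low high tN →
                      a :+ (b :+ (xN :+ low :+ high :+ tN)) := xN :+ (low :+ (b :+ (a :+ con 0))) :+ high :+ tN)
                 ≈-refl a b xN low high tN ⟩
      xN + (low + (b + (a + 0#))) + high + tN
        ≈⟨ +-cong (+-cong (+-congˡ grown) (reflexive shifted))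
                  (reflexive (cong (λ k → qpow (suc (2 ℕ.* k)) * t (suc m)) (sym (ℕₚ.+-suc i (D ℕ.+ E))))) ⟩
      Φ i (suc D) E ∎
      where
      a = qpow (2 ℕ.* suc D)
      b = qpow (suc (2 ℕ.* D))
      xN = x (suc m)
      low = powSum 1 (2 ℕ.* D)
      high = powSum (suc (2 ℕ.* (suc i ℕ.+ D))) (2 ℕ.* E)
      tN = qpow (suc (2 ℕ.* (suc i ℕ.+ (D ℕ.+ E)))) * t (suc m)
      shifted : high ≡ powSum (suc (2 ℕ.* (i ℕ.+ suc D))) (2 ℕ.* E)
      shifted = cong (λ k → powSum (suc (2 ℕ.* k)) (2 ℕ.* E)) (sym (ℕₚ.+-suc i D))
      grown : low + (b + (a + 0#)) ≈ powSum 1 (2 ℕ.* suc D)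
      grown = begin
        low + (b + (a + 0#))                 ≡⟨ cong (λ e → low + (b + (qpow e + 0#))) (ℕₚ.*-suc 2 D) ⟩
        low + powSum (suc (2 ℕ.* D)) 2       ≈⟨ powSum-+ 1 (2 ℕ.* D) 2 ⟨
        powSum 1 (2 ℕ.* D ℕ.+ 2)             ≡⟨ cong (powSum 1) (trans (ℕₚ.+-comm (2 ℕ.* D) 2) (sym (ℕₚ.*-suc 2 D))) ⟩
        powSum 1 (2 ℕ.* suc D)               ∎

    Φ-ascent : ∀ i D E →
      qpow (2 ℕ.* suc (i ℕ.+ D)) + (qpow (suc (2 ℕ.* (i ℕ.+ D))) + Φ (suc i) D E) ≈ Φ i D (suc E)
    Φ-ascent i D E = begin
      a + (b + (xN + low + high + tN))
        ≈⟨ solve 6 (λ a b xN low high tN →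
                      a :+ (b :+ (xN :+ low :+ high :+ tN)) := xN :+ low :+ ((b :+ (a :+ con 0)) :+ high) :+ tN)
                 ≈-refl a b xN low high tN ⟩
      xN + low + ((b + (a + 0#)) + high) + tN
        ≈⟨ +-cong (+-congˡ grown)
                  (reflexive (cong (λ k → qpow (suc (2 ℕ.* k)) * t (suc m))
                                   (sym (trans (cong (i ℕ.+_) (ℕₚ.+-suc D E)) (ℕₚ.+-suc i (D ℕ.+ E)))))) ⟩
      Φ i D (suc E) ∎
      where
      s = suc (2 ℕ.* (i ℕ.+ D))
      a = qpow (2 ℕ.* suc (i ℕ.+ D))
      b = qpow s
      xN = x (suc m)
      low = powSum 1 (2 ℕ.* D)
      high = powSum (suc (2 ℕ.* (suc i ℕ.+ D))) (2 ℕ.* E)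
      tN = qpow (suc (2 ℕ.* (suc i ℕ.+ (D ℕ.+ E)))) * t (suc m)
      grown : (b + (a + 0#)) + high ≈ powSum s (2 ℕ.* suc E)
      grown = begin
        (b + (a + 0#)) + high
          ≡⟨ cong₂ (λ e f → (b + (qpow e + 0#)) + powSum f (2 ℕ.* E))
                   (ℕₚ.*-suc 2 (i ℕ.+ D))
                   (cong suc (trans (ℕₚ.*-suc 2 (i ℕ.+ D)) (ℕₚ.+-comm 2 (2 ℕ.* (i ℕ.+ D))))) ⟩
        powSum s 2 + powSum (s ℕ.+ 2) (2 ℕ.* E)   ≈⟨ powSum-+ s 2 (2 ℕ.* E) ⟨
        powSum s (2 ℕ.+ 2 ℕ.* E)                  ≡⟨ cong (powSum s) (sym (ℕₚ.*-suc 2 E)) ⟩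
        powSum s (2 ℕ.* suc E)                    ∎

    Φ-step : ∀ i p b w →
      qpow (2 ℕ.* suc (gap i p b w))
        + (qpow (suc (2 ℕ.* gap i p b w)) + Φ (suc i) (descentCount (b ∷ w)) (ascentCount (b ∷ w)))
        ≈ Φ i (descentCount (p ∷ b ∷ w)) (ascentCount (p ∷ b ∷ w))
    Φ-step i p b w with b <ᵇℤ p
    ... | true = Φ-descent i (descentCount (b ∷ w)) (ascentCount (b ∷ w))
    ... | false = Φ-ascent i (descentCount (b ∷ w)) (ascentCount (b ∷ w))

    ∑-insertions-weight : ∀ i p w → ∣ p ∣ < suc m → All (λ b → ∣ b ∣ < suc m) w →
      ∑ (insertions (signedPair (suc m)) w) (weight i p)
        ≈ weight i p w * Φ i (descentCount (p ∷ w)) (ascentCount (p ∷ w))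
    ∑-insertions-weight i p [] p<1+m [] = begin
      weight i p (+ suc m ∷ []) + (weight i p (-[1+ m ] ∷ []) + 0#)
        ≈⟨ +-cong (*-congˡ (reflexive (cong qpow (exponent-last+ i p p<1+m))))
                  (+-congʳ (*-congˡ (reflexive (cong qpow (exponent-last- i p p<1+m))))) ⟩
      (x (suc m) * 1#) * 1# + ((t (suc m) * 1#) * qpow (suc (2 ℕ.* (i ℕ.+ 0))) + 0#)
        ≈⟨ solve 3 (λ X T Q → (X :* con 1) :* con 1 :+ ((T :* con 1) :* Q :+ con 0)
                              := (con 1 :* con 1) :* (X :+ con 0 :+ con 0 :+ Q :* T))
                 ≈-refl (x (suc m)) (t (suc m)) (qpow (suc (2 ℕ.* (i ℕ.+ 0)))) ⟩
      weight i p [] * Φ i 0 0 ∎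
    ∑-insertions-weight i p (b ∷ w) p<1+m (b<1+m ∷ w<1+m) = begin
      weight i p (+ suc m ∷ b ∷ w) + (weight i p (-[1+ m ] ∷ b ∷ w) + ∑ (map (b ∷_) (insertions ±N w)) (weight i p))
        ≈⟨ +-cong (weight-prepend i p (+ suc m) (b ∷ w) _ (rlMinWeight-notMin (+ suc m) b w N≮b)
                                  (exponent-insert+ i p b w p<1+m b<1+m))
                  (+-cong (weight-prepend i p -[1+ m ] (b ∷ w) _ (rlMinWeight-notMin -[1+ m ] b w N≮b)
                                          (exponent-insert- i p b w p<1+m b<1+m))
                          later) ⟩
      g * qpow (2 ℕ.* suc gp) + (g * qpow (suc (2 ℕ.* gp)) + g * Φ (suc i) D E)
        ≈⟨ ≈-trans (+-congˡ (≈-sym (distribˡ g _ _))) (≈-sym (distribˡ g _ _)) ⟩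
      g * (qpow (2 ℕ.* suc gp) + (qpow (suc (2 ℕ.* gp)) + Φ (suc i) D E))
        ≈⟨ *-congˡ (Φ-step i p b w) ⟩
      g * Φ i (descentCount (p ∷ b ∷ w)) (ascentCount (p ∷ b ∷ w)) ∎
      where
      ±N = signedPair (suc m)
      g = weight i p (b ∷ w)
      gp = gap i p b w
      D = descentCount (b ∷ w)
      E = ascentCount (b ∷ w)
      c = rlMinFactor b w * qpow (exponentStep i p b)
      N≮b : (suc m <ᵇ ∣ b ∣) ≡ false
      N≮b = dec-false (suc m ℕ.<? ∣ b ∣) (ℕₚ.<⇒≯ b<1+m)
      b<±N : ∀ {a} → a ∈ ±N → (∣ b ∣ <ᵇ ∣ a ∣) ≡ true
      b<±N (here refl) = Equivalence.to T-≡ (ℕₚ.<⇒<ᵇ b<1+m)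
      b<±N (there (here refl)) = Equivalence.to T-≡ (ℕₚ.<⇒<ᵇ b<1+m)
      factor-stable : ∀ {u} → u ∈ insertions ±N w → rlMinFactor b u ≡ rlMinFactor b w
      factor-stable u∈ = cong (λ β → if β then (if b <ᵇℤ zeroℤ then t ∣ b ∣ else x ∣ b ∣) else 1#)
                              (all-insertions (λ a → ∣ b ∣ <ᵇ ∣ a ∣) b<±N w u∈)
      later : ∑ (map (b ∷_) (insertions ±N w)) (weight i p) ≈ g * Φ (suc i) D E
      later = begin
        ∑ (map (b ∷_) (insertions ±N w)) (weight i p)
          ≡⟨ ∑-map (b ∷_) (insertions ±N w) (weight i p) ⟩
        ∑ (insertions ±N w) (weight i p ∘ (b ∷_))
          ≈⟨ ∑-cong (insertions ±N w) (λ {u} u∈ → ≈-trans (weight-cons i p b u)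
                                          (*-congʳ (*-congʳ (reflexive (factor-stable u∈))))) ⟩
        ∑ (insertions ±N w) (λ u → c * weight (suc i) b u)
          ≈⟨ ∑-*ˡ c (insertions ±N w) (weight (suc i) b) ⟩
        c * ∑ (insertions ±N w) (weight (suc i) b)
          ≈⟨ *-congˡ (∑-insertions-weight (suc i) b w b<1+m w<1+m) ⟩
        c * (weight (suc i) b w * Φ (suc i) D E)
          ≈⟨ *-assoc _ _ _ ⟨
        (c * weight (suc i) b w) * Φ (suc i) D E
          ≈⟨ *-congʳ (weight-cons i p b w) ⟨
        g * Φ (suc i) D E ∎

    Φ-zero : ∀ D E → D ℕ.+ E ≡ m → Φ 0 D E ≈ factor (suc m)
    Φ-zero D E D+E≡m = begin
      xN + powSum 1 (2 ℕ.* D) + powSum (suc (2 ℕ.* D)) (2 ℕ.* E) + qpow (suc (2 ℕ.* (D ℕ.+ E))) * tN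
        ≈⟨ +-congʳ (+-assoc _ _ _) ⟩
      xN + (powSum 1 (2 ℕ.* D) + powSum (suc (2 ℕ.* D)) (2 ℕ.* E)) + qpow (suc (2 ℕ.* (D ℕ.+ E))) * tN
        ≈⟨ +-congʳ (+-congˡ (powSum-+ 1 (2 ℕ.* D) (2 ℕ.* E))) ⟨
      xN + powSum 1 (2 ℕ.* D ℕ.+ 2 ℕ.* E) + qpow (suc (2 ℕ.* (D ℕ.+ E))) * tN
        ≡⟨ cong₂ (λ k l → xN + powSum 1 k + qpow (suc l) * tN)
                 (trans (sym (ℕₚ.*-distribˡ-+ 2 D E)) twice) twice ⟩
      xN + powSum 1 (2 ℕ.* m) + qpow (suc (2 ℕ.* m)) * tN
        ≈⟨ +-congʳ (+-congˡ (∑-oneTo (2 ℕ.* m))) ⟨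
      xN + ∑ (oneTo (2 ℕ.* m)) qpow + qpow (suc (2 ℕ.* m)) * tN
        ≡⟨ cong₂ (λ k l → xN + ∑ (oneTo k) qpow + qpow l * tN)
                 (cong (ℕ._∸ 2) (sym (ℕₚ.*-suc 2 m))) (cong (ℕ._∸ 1) (sym (ℕₚ.*-suc 2 m))) ⟩
      factor (suc m) ∎
      where
      xN = x (suc m)
      tN = t (suc m)
      twice : 2 ℕ.* (D ℕ.+ E) ≡ 2 ℕ.* m
      twice = cong (2 ℕ.*_) D+E≡m

  lhs-suc : ∀ m → lhs R (suc m) x t q ≈ lhs R m x t q * factor (suc m)
  lhs-suc m = begin
    ∑ (B (suc m)) (weight 0 zeroℤ)
      ≈⟨ ∑-B-suc m (weight 0 zeroℤ) ⟩
    ∑ (B m) (λ σ → ∑ (insertions (signedPair (suc m)) σ) (weight 0 zeroℤ))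
      ≈⟨ ∑-cong (B m) inserted ⟩
    ∑ (B m) (λ σ → weight 0 zeroℤ σ * factor (suc m))
      ≈⟨ ∑-*ʳ (factor (suc m)) (B m) (weight 0 zeroℤ) ⟩
    lhs R m x t q * factor (suc m) ∎
    where
    inserted : ∀ {σ} → σ ∈ B m →
      ∑ (insertions (signedPair (suc m)) σ) (weight 0 zeroℤ) ≈ weight 0 zeroℤ σ * factor (suc m)
    inserted {σ} σ∈ with ∈-B⁻ m σ∈
    ... | length≡m , bounded = ≈-trans
      (∑-insertions-weight m 0 zeroℤ σ (s≤s ℕ.z≤n) bounded)
      (*-congˡ (Φ-zero m (descentCount (zeroℤ ∷ σ)) (ascentCount (zeroℤ ∷ σ))
                         (trans (descentCount+ascentCount zeroℤ σ) length≡m)))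

  rhs-suc : ∀ m → rhs R (suc m) x t q ≈ rhs R m x t q * factor (suc m)
  rhs-suc m = begin
    prodR R (map factor (oneTo (suc m)))                      ≡⟨ cong (prodR R ∘ map factor) (oneTo-suc m) ⟩
    prodR R (map factor (oneTo m ++ suc m ∷ []))              ≈⟨ prodR-++ (oneTo m) (suc m ∷ []) factor ⟩
    prodR R (map factor (oneTo m)) * (factor (suc m) * 1#)    ≈⟨ *-congˡ (*-identityʳ _) ⟩
    prodR R (map factor (oneTo m)) * factor (suc m)           ∎

  lhs≈rhs : ∀ n → lhs R n x t q ≈ rhs R n x t q
  lhs≈rhs zero = ≈-trans (+-identityʳ _) (*-identityˡ _)
  lhs≈rhs (suc m) = begin
    lhs R (suc m) x t q               ≈⟨ lhs-suc m ⟩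
    lhs R m x t q * factor (suc m)    ≈⟨ *-congʳ (lhs≈rhs m) ⟩
    rhs R m x t q * factor (suc m)    ≈⟨ rhs-suc m ⟨
    rhs R (suc m) x t q               ∎

-- The identity also holds for n = 0 (both sides are 1).
theorem7p3 : {c ℓ : Level} (R : CommutativeSemiring c ℓ) (n : ℕ) → 1 ≤ n →
    (x t : ℕ → CommutativeSemiring.Carrier R) (q : CommutativeSemiring.Carrier R) →
    CommutativeSemiring._≈_ R (lhs R n x t q) (rhs R n x t q)
theorem7p3 R n _ x t q = GeneratingFunction.lhs≈rhs R x t q n
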